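{- Let $\mathcal{M}$ be an $\mathit{LTL}$-model, $[n_1,\ldots,n_k]$ an observation sequence, and $A$ an $\mathit{LTL}$-formula. Then $\mathcal{M},[n_1,\ldots,n_k]\models_{\nabla} A^*$ if and only if $\mathcal{M},[n_k]\models_{\nabla} A^*$.
   Context: Fix a set $\mathcal{P}$ of propositional symbols. $\mathit{LTL}$-formulas: $A ::= p \mid \bot \mid A\supset A \mid \mathsf{G}A \mid \mathsf{X}A \mid A\,\mathsf{U}\,A$ ($p\in\mathcal{P}$). $\mathit{LTL}_\nabla$-formulas: $A ::= p \mid \bot \mid A\supset A \mid \mathsf{G}A \mid \mathsf{X}A \mid \nabla A$. In both languages $\neg A := A\supset\bot$, $A\vee B := \neg A\supset B$, $A\wedge B := \neg(\neg A\vee\neg B)$, $\mathsf{F}A := \neg\mathsf{G}\neg A$. An $\mathit{LTL}$-model is $\mathcal{M}=\langle \mathbb{N},\mathcal{V}\rangle$ with $\mathcal{V}:\mathbb{N}\to 2^{\mathcal{P}}$. An observation sequence is a non-empty finite sequence $[n_0,\ldots,n_k]$ of natural numbers. Truth $\models_\nabla$ of $\mathit{LTL}_\nabla$-formulas at observation sequences: $\mathcal{M},[n_0,\ldots,n_k]\models_\nabla p$ iff $p\in\mathcal{V}(n_k)$; $\bot$ is never true; $\supset$ is classical implication at the same sequence; $\mathcal{M},[n_0,\ldots,n_k]\models_\nabla\mathsf{G}A$ iff $\mathcal{M},[n_0,\ldots,n_k,m]\models_\nabla A$ for all $m\ge n_k$; $\mathcal{M},[n_0,\ldots,n_k]\models_\nabla\mathsf{X}A$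 iff $\mathcal{M},[n_0,\ldots,n_k,n_k+1]\models_\nabla A$; if $k>0$, $\mathcal{M},[n_0,\ldots,n_{k-1},n_k]\models_\nabla\nabla A$ iff $\mathcal{M},[n_0,\ldots,n_{k-1},m]\models_\nabla A$ for all $m$ with $n_{k-1}\le m\le n_k$; and $\mathcal{M},[n_0]\models_\nabla\nabla A$ iff $\mathcal{M},[n_0]\models_\nabla A$. The translation $(\cdot)^*$: $p^*=p$, $\bot^*=\bot$, $(A\supset B)^*=A^*\supset B^*$, $(\mathsf{G}A)^*=\mathsf{G}A^*$, $(\mathsf{X}A)^*=\mathsf{X}A^*$, $(A\,\mathsf{U}\,B)^* = B^*\vee \mathsf{F}(\mathsf{X}B^*\wedge\nabla A^*)$. -}

module Defs where

open import Data.Nat using (ℕ; suc; _≤_)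
open import Data.Empty using (⊥)

data LTL (P : Set) : Set where
  atom : P → LTL P
  bot  : LTL P
  _⊃_  : LTL P → LTL P → LTL P
  G    : LTL P → LTL P
  X    : LTL P → LTL P
  _U_  : LTL P → LTL P → LTL P

data LTL∇ (P : Set) : Set where
  atom : P → LTL∇ P
  bot  : LTL∇ P
  _⊃_  : LTL∇ P → LTL∇ P → LTL∇ P
  G    : LTL∇ P → LTL∇ P
  X    : LTL∇ P → LTL∇ P
  ∇    : LTL∇ P → LTL∇ P

module _ {P : Set} where
  ¬' : LTL∇ P → LTL∇ P
  ¬' A = A ⊃ bot

  _∨'_ : LTL∇ P → LTL∇ P → LTL∇ P
  A ∨' B = ¬' A ⊃ B

  _∧'_ : LTL∇ P → LTL∇ P → LTL∇ P
  A ∧' B = ¬' (¬' A ∨' ¬' B)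

  F' : LTL∇ P → LTL∇ P
  F' A = ¬' (G (¬' A))

-- LTL-model ⟨ℕ, V⟩ with V : ℕ → 2^P (subsets of P as predicates)
Model : Set → Set₁
Model P = ℕ → P → Set

-- observation sequences: non-empty finite sequences of naturals,
-- built by appending on the right: [ n₀ ] ▷ n₁ ▷ ... ▷ nₖ
data ObsSeq : Set where
  [_] : ℕ → ObsSeq
  _▷_ : ObsSeq → ℕ → ObsSeq

infixl 5 _▷_

lastObs : ObsSeq → ℕ
lastObs [ n ] = n
lastObs (s ▷ n) = n

Sat : {P : Set} → Model P → ObsSeq → LTL∇ P → Set
Sat V s (atom p) = V (lastObs s) p
Sat V s bot = ⊥
Sat V s (A ⊃ B) = Sat V s A → Sat V s B
Sat V s (G A) = ∀ m → lastObs s ≤ m → Sat V (s ▷ m) A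
Sat V s (X A) = Sat V (s ▷ suc (lastObs s)) A
Sat V [ n ] (∇ A) = Sat V [ n ] A
Sat V (s ▷ n) (∇ A) = ∀ m → lastObs s ≤ m → m ≤ n → Sat V (s ▷ m) A

tr : {P : Set} → LTL P → LTL∇ P
tr (atom p) = atom p
tr bot = bot
tr (A ⊃ B) = tr A ⊃ tr B
tr (G A) = G (tr A)
tr (X A) = X (tr A)
tr (A U B) = tr B ∨' F' (X (tr B) ∧' ∇ (tr A))

-- Truth of an LTL∇-formula at an observation sequence depends on the whole
-- sequence only through ∇.  In a translation A*, ∇ occurs only in the pattern
-- F (X B* ∧ ∇ A*), i.e. directly under G, where it is evaluated at s ▷ m and
-- only looks back to lastObs s.  Hence the truth of A* at s depends on lastObs s
-- alone, and [ lastObs s ] is a sequence with the same last observation.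
module Submission where

open import Defs
open import Function.Bundles using (_⇔_; mk⇔)
open import Relation.Binary.PropositionalEquality using (_≡_; refl; sym; cong; subst)
open import Data.Nat using (suc; _≤_)

module _ {P : Set} (M : Model P) where

  SameLast : ObsSeq → ObsSeq → Set
  SameLast s t = lastObs s ≡ lastObs t

  -- Records rather than type synonyms, so that the formula index can be inferred.
  record LastDetermined (A : LTL∇ P) : Set where
    constructor lastDetermined
    field transfer : ∀ s t → SameLast s t → Sat M s A → Sat M t A
  open LastDetermined

  -- The invariant for formulas evaluated directly under G, which may contain ∇.
  record UnderGDetermined (A : LTL∇ P) : Set where
    constructor underGDetermined
    field transferUnderG : ∀ s t m → SameLast s t → Sat M (s ▷ m) A → Sat M (t ▷ m) A
  open UnderGDetermined

  ⊃-lastDetermined : ∀ {A B} → LastDetermined A → LastDetermined B →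
                     LastDetermined (A ⊃ B)
  ⊃-lastDetermined hA hB = lastDetermined λ s t eq f x →
    transfer hB s t eq (f (transfer hA t s (sym eq) x))

  bot-lastDetermined : LastDetermined bot
  bot-lastDetermined = lastDetermined λ _ _ _ ()

  ¬-lastDetermined : ∀ {A} → LastDetermined A → LastDetermined (¬' A)
  ¬-lastDetermined hA = ⊃-lastDetermined hA bot-lastDetermined

  ∨-lastDetermined : ∀ {A B} → LastDetermined A → LastDetermined B →
                     LastDetermined (A ∨' B)
  ∨-lastDetermined hA = ⊃-lastDetermined (¬-lastDetermined hA)

  lastDetermined⇒underGDetermined : ∀ {A} → LastDetermined A → UnderGDetermined A
  lastDetermined⇒underGDetermined hA = underGDetermined λ s t m _ →
    transfer hA (s ▷ m) (t ▷ m) refl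

  ∇-underGDetermined : ∀ {A} → LastDetermined A → UnderGDetermined (∇ A)
  ∇-underGDetermined hA = underGDetermined λ s t m eq h j l₁ l₂ →
    transfer hA (s ▷ j) (t ▷ j) refl (h j (subst (_≤ j) (sym eq) l₁) l₂)

  ⊃-underGDetermined : ∀ {A B} → UnderGDetermined A → UnderGDetermined B →
                       UnderGDetermined (A ⊃ B)
  ⊃-underGDetermined hA hB = underGDetermined λ s t m eq f x →
    transferUnderG hB s t m eq (f (transferUnderG hA t s m (sym eq) x))

  ¬-underGDetermined : ∀ {A} → UnderGDetermined A → UnderGDetermined (¬' A)
  ¬-underGDetermined hA =
    ⊃-underGDetermined hA (lastDetermined⇒underGDetermined bot-lastDetermined)

  ∧-underGDetermined : ∀ {A B} → UnderGDetermined A → UnderGDetermined B →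
                       UnderGDetermined (A ∧' B)
  ∧-underGDetermined hA hB = ¬-underGDetermined
    (⊃-underGDetermined (¬-underGDetermined (¬-underGDetermined hA))
                        (¬-underGDetermined hB))

  G-lastDetermined : ∀ {A} → UnderGDetermined A → LastDetermined (G A)
  G-lastDetermined hA = lastDetermined λ s t eq h m le →
    transferUnderG hA s t m eq (h m (subst (_≤ m) (sym eq) le))

  F-lastDetermined : ∀ {A} → UnderGDetermined A → LastDetermined (F' A)
  F-lastDetermined hA =
    ¬-lastDetermined (G-lastDetermined (¬-underGDetermined hA))

  X-lastDetermined : ∀ {A} → LastDetermined A → LastDetermined (X A)
  X-lastDetermined hA = lastDetermined λ s t eq →
    transfer hA (s ▷ suc (lastObs s)) (t ▷ suc (lastObs t)) (cong suc eq)

  tr-lastDetermined : (A : LTL P) → LastDetermined (tr A)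
  tr-lastDetermined (atom p) = lastDetermined λ s t eq → subst (λ n → M n p) eq
  tr-lastDetermined bot = bot-lastDetermined
  tr-lastDetermined (A ⊃ B) =
    ⊃-lastDetermined (tr-lastDetermined A) (tr-lastDetermined B)
  tr-lastDetermined (G A) =
    G-lastDetermined (lastDetermined⇒underGDetermined (tr-lastDetermined A))
  tr-lastDetermined (X A) = X-lastDetermined (tr-lastDetermined A)
  tr-lastDetermined (A U B) =
    ∨-lastDetermined (tr-lastDetermined B)
      (F-lastDetermined
        (∧-underGDetermined
          (lastDetermined⇒underGDetermined (X-lastDetermined (tr-lastDetermined B)))
          (∇-underGDetermined (tr-lastDetermined A))))

corollary1 : {P : Set} (M : Model P) (s : ObsSeq) (A : LTL P) →
    Sat M s (tr A) ⇔ Sat M [ lastObs s ] (tr A)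
corollary1 M s A =
  mk⇔ (transfer s [ lastObs s ] refl) (transfer [ lastObs s ] s refl)
  where open LastDetermined (tr-lastDetermined M A)
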